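{- Let $T,T'$ be trees of size $n$. Then the least upper bound $T''$ of $T$ and $T'$ in the Tamari lattice $\mathcal T_n$ satisfies $T''=T*N_r(c_T^{ -1}c_{T'})=T'*D_r(c_T^{ -1}c_{T'})$.
   Context: Trees: finite binary rooted trees; $\bullet$ the one-leaf tree, $T_0\wedge T_1$ the tree with left and right subtrees $T_0,T_1$; size = number of internal nodes. Addresses: finite words over $\{0,1\}$; the $\alpha$-subtree of $T$: the $\emptyset$-subtree is $T$, and for $T=T_0\wedge T_1$ the $i\beta$-subtree is the $\beta$-subtree of $T_i$. Left rotation at $\alpha$ replaces an $\alpha$-subtree $T_0\wedge(T_1\wedge T_2)$ by $(T_0\wedge T_1)\wedge T_2$; $\mathcal T_n$ is the set of size-$n$ trees with the Tamari order ($T\le T'$ iff $T'$ is obtained from $T$ by finitely many left rotations), a lattice. For a letter $a_\alpha$, $T*a_\alpha$ is the left rotation of $T$ at $\alpha$ (when defined); for a positive word $u=a_{\alpha_1}\cdots a_{\alpha_m}$, $T*u$ means applying these successively. The right comb is $C_0=\bullet$, $C_n=\bullet\wedge C_{n-1}$. For each size-$n$ tree $T$, $c_T$ denotes a positive word in the letters $a_\alpha$ with $C_n*c_T=T$ (any two such words represent the same element of Thompson's group $F$, in which $a_\alpha$ is the element acting by left rotation at $\alpha$). $\mathbf R$: for all addresses $\alpha,\beta$, $a_\alpha a_\beta=a_\beta a_\alpha$ when $\alpha\perp\beta$ (some $\gamma$ has $\alpha$ beginning with $\gamma0$, $\beta$ with $\gamma1$, or vice versa); $a_{\alpha11\beta}a_\alpha=a_\alpha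 a_{\alpha1\beta}$; $a_{\alpha10\beta}a_\alpha=a_\alpha a_{\alpha01\beta}$; $a_{\alpha0\beta}a_\alpha=a_\alpha a_{\alpha00\beta}$; $a_\alpha^2=a_{\alpha1}a_\alpha a_{\alpha0}$. Right-$\mathbf R$-reversing step on a word in letters $a_\alpha^{\pm1}$: delete a factor $a^{ -1}a$, or replace a factor $a^{ -1}b$ by $vu^{ -1}$ with $u,v$ positive words such that $av=bu$ is a relation of $\mathbf R$ (either orientation). For every such word $w$ there are unique positive words $N_r(w),D_r(w)$ such that $w$ is transformed by finitely many right-reversing steps into $N_r(w)D_r(w)^{ -1}$. -}

module Defs where

open import Data.Nat using (ℕ; zero; suc; _+_)
open import Data.Bool using (Bool; true; false)
open import Data.List using (List; []; _∷_; _++_; map; reverse)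
open import Data.Maybe using (Maybe; just; nothing; _>>=_)
import Data.Maybe as Maybe
open import Data.Product using (Σ; ∃; ∃-syntax; _×_; _,_)
open import Data.Sum using (_⊎_)
open import Relation.Binary.PropositionalEquality using (_≡_)
open import Relation.Binary.Construct.Closure.ReflexiveTransitive using (Star)

infixr 5 _∧_

data Tree : Set where
  ● : Tree
  _∧_ : Tree → Tree → Tree

size : Tree → ℕ
size ● = 0
size (t₀ ∧ t₁) = suc (size t₀ + size t₁)

comb : ℕ → Tree
comb zero = ●
comb (suc n) = ● ∧ comb n

-- addresses: finite words over {0,1}; false = 0, true = 1
Address : Set
Address = List Bool

rotate : Address → Tree → Maybe Tree
rotate [] (t₀ ∧ (t₁ ∧ t₂)) = just ((t₀ ∧ t₁) ∧ t₂)
rotate [] _ = nothing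
rotate (_ ∷ _) ● = nothing
rotate (false ∷ α) (t₀ ∧ t₁) = Maybe.map (λ s → s ∧ t₁) (rotate α t₀)
rotate (true ∷ α) (t₀ ∧ t₁) = Maybe.map (λ s → t₀ ∧ s) (rotate α t₁)

-- positive words: a_{α₁} ⋯ a_{αₘ} is the list α₁ ∷ ⋯ ∷ αₘ ∷ []
PosWord : Set
PosWord = List Address

_*_ : Tree → PosWord → Maybe Tree
T * [] = just T
T * (α ∷ u) = rotate α T >>= λ T₁ → T₁ * u

_≤T_ : Tree → Tree → Set
T ≤T T' = ∃[ u ] (T * u ≡ just T')

IsLub : ℕ → Tree → Tree → Tree → Set
IsLub n T T' T'' =
  size T'' ≡ n × T ≤T T'' × T' ≤T T'' ×
  ((S : Tree) → size S ≡ n → T ≤T S → T' ≤T S → T'' ≤T S)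

IsCWord : Tree → PosWord → Set
IsCWord T c = comb (size T) * c ≡ just T

_⊥_ : Address → Address → Set
α ⊥ β = ∃[ γ ] ∃[ δ ] ∃[ ε ]
  ((α ≡ γ ++ (false ∷ δ) × β ≡ γ ++ (true ∷ ε)) ⊎
   (α ≡ γ ++ (true ∷ δ) × β ≡ γ ++ (false ∷ ε)))

-- the relations of R, written  lhs = rhs  as pairs of positive words
data RelR : PosWord → PosWord → Set where
  comm : ∀ α β → α ⊥ β → RelR (α ∷ β ∷ []) (β ∷ α ∷ [])
  r11 : ∀ α β → RelR ((α ++ (true ∷ true ∷ β)) ∷ α ∷ []) (α ∷ (α ++ (true ∷ β)) ∷ [])
  r10 : ∀ α β → RelR ((α ++ (true ∷ false ∷ β)) ∷ α ∷ []) (α ∷ (α ++ (false ∷ true ∷ β)) ∷ [])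
  r0 : ∀ α β → RelR ((α ++ (false ∷ β)) ∷ α ∷ []) (α ∷ (α ++ (false ∷ false ∷ β)) ∷ [])
  pent : ∀ α → RelR (α ∷ α ∷ []) ((α ++ (true ∷ [])) ∷ α ∷ (α ++ (false ∷ [])) ∷ [])

data Letter : Set where
  pos : Address → Letter
  neg : Address → Letter

Word : Set
Word = List Letter

posW : PosWord → Word
posW u = map pos u

invW : PosWord → Word
invW u = map neg (reverse u)

data RevStep : Word → Word → Set where
  cancel : ∀ x y a → RevStep (x ++ (neg a ∷ pos a ∷ y)) (x ++ y)
  rev : ∀ x y a b u v →
        (RelR (a ∷ v) (b ∷ u) ⊎ RelR (b ∷ u) (a ∷ v)) →
        RevStep (x ++ (neg a ∷ pos b ∷ y)) (x ++ (posW v ++ (invW u ++ y)))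

_↝*_ : Word → Word → Set
_↝*_ = Star RevStep

module Submission where

-- 1. Right-size sequences: rs T lists in infix order the sizes of the right
--    subtrees of T.  Rotations keep the size and decrease rs entrywise, and
--    rs is injective, so X ⊑ S (rs S ≤ rs X entrywise) is an antisymmetric
--    relation containing the Tamari order.
-- 2. Reversing squares: for each relation a v = b u of R, if a and b rotate
--    S₀ to X and Y, then v and u lead X and Y to a common W whose rs-entries
--    are copied from rs X or rs Y; hence W ⊑ S whenever X, Y ⊑ S.
-- 3. Zigzags: w is a path of backward and forward rotations T → C_n → T'
--    through trees ⊑ T''; by 2 every reversing step preserves such paths, so
--    N_r D_r⁻¹ yields T * N_r = Z = T' * D_r with Z ⊑ T''.  Being an upper
--    bound, Z ≥ T'', and antisymmetry of ⊑ gives Z = T''.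

open import Defs
open import Data.Nat using (ℕ; suc; _+_; _≤_; _<_; s≤s; z≤n)
open import Data.Nat.Properties
  using (≤-refl; ≤-trans; ≤-reflexive; ≤-antisym; <⇒≱; 0≢1+n; suc-injective; +-suc; +-assoc; +-identityʳ; m≤m+n; m≤n⇒m≤1+n)
open import Data.List using (List; []; _∷_; _++_; map; reverse; length)
open import Data.List.Properties
  using (++-assoc; ++-identityʳ; ++-cancelˡ; map-++; map-∘; map-id; unfold-reverse; ∷-injective)
open import Data.List.Relation.Binary.Pointwise as Pw using (Pointwise; []; _∷_)
open import Data.Maybe using (Maybe; just; _>>=_)
import Data.Maybe as Maybe
open import Data.Maybe.Properties using (just-injective)
open import Data.Bool using (true; false)
open import Data.Product using (_×_; _,_; ∃-syntax; proj₂)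
open import Data.Sum using (_⊎_; inj₁; inj₂)
open import Data.Empty using (⊥-elim)
open import Data.Unit using (⊤; tt)
open import Relation.Binary.PropositionalEquality
open import Relation.Binary.Construct.Closure.ReflexiveTransitive using (ε; _◅_)

open ≡-Reasoning

map-just⁻ : ∀ {A B : Set} {f : A → B} (m : Maybe A) {y : B} →
  Maybe.map f m ≡ just y → ∃[ x ] m ≡ just x × f x ≡ y
map-just⁻ (just x) refl = x , refl , refl

bind-just⁻ : ∀ {A B : Set} (m : Maybe A) {f : A → Maybe B} {y : B} →
  (m >>= f) ≡ just y → ∃[ x ] m ≡ just x × f x ≡ just y
bind-just⁻ (just x) h = x , refl , h

infix 4 _≤*_
_≤*_ : List ℕ → List ℕ → Set
_≤*_ = Pointwise _≤_

≤*-refl : ∀ {xs} → xs ≤* xs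
≤*-refl = Pw.refl ≤-refl

≤*-trans : ∀ {xs ys zs} → xs ≤* ys → ys ≤* zs → xs ≤* zs
≤*-trans = Pw.transitive ≤-trans

-- rsAcc T acc = rs T ++ acc.  The accumulator makes rs of trees built from
-- the same pieces in the same infix order definitionally comparable.
rsAcc : Tree → List ℕ → List ℕ
rsAcc ● acc = acc
rsAcc (A ∧ B) acc = rsAcc A (size B ∷ rsAcc B acc)

rs : Tree → List ℕ
rs T = rsAcc T []

rsAcc-++ : ∀ T acc → rsAcc T acc ≡ rs T ++ acc
rsAcc-++ ● acc = refl
rsAcc-++ (A ∧ B) acc = begin
  rsAcc A (size B ∷ rsAcc B acc)   ≡⟨ rsAcc-++ A _ ⟩
  rs A ++ size B ∷ rsAcc B acc     ≡⟨ cong (λ l → rs A ++ size B ∷ l) (rsAcc-++ B acc) ⟩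
  rs A ++ size B ∷ (rs B ++ acc)   ≡⟨ ++-assoc (rs A) (size B ∷ rs B) acc ⟨
  (rs A ++ size B ∷ rs B) ++ acc   ≡⟨ cong (_++ acc) (rsAcc-++ A _) ⟨
  rs (A ∧ B) ++ acc                ∎

rs-∧ : ∀ A B → rs (A ∧ B) ≡ rs A ++ size B ∷ rs B
rs-∧ A B = rsAcc-++ A _

length-rsAcc : ∀ T acc → length (rsAcc T acc) ≡ size T + length acc
length-rsAcc ● acc = refl
length-rsAcc (A ∧ B) acc = begin
  length (rsAcc A (size B ∷ rsAcc B acc)) ≡⟨ length-rsAcc A _ ⟩
  size A + suc (length (rsAcc B acc))     ≡⟨ cong (λ k → size A + suc k) (length-rsAcc B acc) ⟩
  size A + suc (size B + length acc)      ≡⟨ +-suc (size A) _ ⟩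
  suc (size A + (size B + length acc))    ≡⟨ cong suc (+-assoc (size A) (size B) _) ⟨
  suc (size A + size B + length acc)      ∎

length-rs : ∀ T → length (rs T) ≡ size T
length-rs T = trans (length-rsAcc T []) (+-identityʳ (size T))

length-rs-cong : ∀ {X Y} → size X ≡ size Y → length (rs X) ≡ length (rs Y)
length-rs-cong {X} {Y} e = trans (length-rs X) (trans e (sym (length-rs Y)))

Bounded : List ℕ → Set
Bounded [] = ⊤
Bounded (x ∷ xs) = x ≤ length xs × Bounded xs

bounded-rsAcc : ∀ T {acc} → Bounded acc → Bounded (rsAcc T acc)
bounded-rsAcc ● b = b
bounded-rsAcc (A ∧ B) {acc} b =
  bounded-rsAcc A (size-bound , bounded-rsAcc B b)
  where
  size-bound : size B ≤ length (rsAcc B acc)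
  size-bound = ≤-trans (m≤m+n (size B) (length acc)) (≤-reflexive (sym (length-rsAcc B acc)))

length-<-++-∷ : ∀ {A : Set} (P : List A) {m : A} {Q : List A} → length P < length (P ++ m ∷ Q)
length-<-++-∷ [] = s≤s z≤n
length-<-++-∷ (_ ∷ P) = s≤s (length-<-++-∷ P)

-- In a bounded prefix no entry can equal the length of the rest of the whole
-- list; so an entry m followed by exactly m entries marks a unique position.
-- In rs (A ∧ B) = rs A ++ size B ∷ rs B this position is the root.
tight-position-unique : ∀ P P' {m m' Q Q'} → Bounded P → Bounded P' →
  m ≡ length Q → m' ≡ length Q' → P ++ m ∷ Q ≡ P' ++ m' ∷ Q' → P ≡ P'
tight-position-unique [] [] _ _ _ _ _ = refl
tight-position-unique [] (_ ∷ P') _ (p'≤ , _) m≡ _ refl =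
  ⊥-elim (<⇒≱ (length-<-++-∷ P') (subst (_≤ length P') m≡ p'≤))
tight-position-unique (_ ∷ P) [] (p≤ , _) _ _ m'≡ refl =
  ⊥-elim (<⇒≱ (length-<-++-∷ P) (subst (_≤ length P) m'≡ p≤))
tight-position-unique (p ∷ P) (_ ∷ P') (_ , bP) (_ , bP') m≡ m'≡ eq with ∷-injective eq
... | refl , eq' = cong (p ∷_) (tight-position-unique P P' bP bP' m≡ m'≡ eq')

rs-injective : ∀ S T → rs S ≡ rs T → S ≡ T
rs-injective ● ● _ = refl
rs-injective ● (A ∧ B) e = ⊥-elim (0≢1+n (trans (cong length e) (length-rs (A ∧ B))))
rs-injective (A ∧ B) ● e = ⊥-elim (0≢1+n (trans (cong length (sym e)) (length-rs (A ∧ B))))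
rs-injective (A ∧ B) (A' ∧ B') e = cong₂ _∧_ (rs-injective A A' rsA≡) (rs-injective B B' rsB≡)
  where
  e' : rs A ++ size B ∷ rs B ≡ rs A' ++ size B' ∷ rs B'
  e' = trans (sym (rs-∧ A B)) (trans e (rs-∧ A' B'))
  rsA≡ : rs A ≡ rs A'
  rsA≡ = tight-position-unique (rs A) (rs A') (bounded-rsAcc A tt) (bounded-rsAcc A' tt)
           (sym (length-rs B)) (sym (length-rs B')) e'
  rsB≡ : rs B ≡ rs B'
  rsB≡ = proj₂ (∷-injective (++-cancelˡ (rs A) _ _ (trans e' (cong (_++ _) (sym rsA≡)))))

infix 4 _⊑_
record _⊑_ (X S : Tree) : Set where
  constructor below
  field rs-≥ : rs S ≤* rs X

⊑-refl : ∀ {X} → X ⊑ X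
⊑-refl = below ≤*-refl

⊑-trans : ∀ {X Y S} → X ⊑ Y → Y ⊑ S → X ⊑ S
⊑-trans (below X⊑Y) (below Y⊑S) = below (≤*-trans Y⊑S X⊑Y)

⊑-antisym : ∀ {X Y} → X ⊑ Y → Y ⊑ X → X ≡ Y
⊑-antisym {X} {Y} (below X⊑Y) (below Y⊑X) =
  rs-injective X Y (Pw.Pointwise-≡⇒≡ (Pw.antisymmetric ≤-antisym Y⊑X X⊑Y))

rotate-size : ∀ α T {T'} → rotate α T ≡ just T' → size T' ≡ size T
rotate-size [] (t₀ ∧ (t₁ ∧ t₂)) refl =
  cong suc (trans (cong suc (+-assoc (size t₀) (size t₁) (size t₂))) (sym (+-suc (size t₀) _)))
rotate-size (false ∷ α) (A ∧ B) h with map-just⁻ (rotate α A) h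
... | A' , e , refl = cong (λ k → suc (k + size B)) (rotate-size α A e)
rotate-size (true ∷ α) (A ∧ B) h with map-just⁻ (rotate α B) h
... | B' , e , refl = cong (λ k → suc (size A + k)) (rotate-size α B e)

rsAcc-mono : ∀ T {l₁ l₂} → l₁ ≤* l₂ → rsAcc T l₁ ≤* rsAcc T l₂
rsAcc-mono ● p = p
rsAcc-mono (A ∧ B) p = rsAcc-mono A (≤-refl ∷ rsAcc-mono B p)

-- A left rotation decreases the right-size sequence: only the entry of the
-- rotated node changes, from 1 + |t₁| + |t₂| to |t₁|.
rotate-rsAcc : ∀ α T {T'} → rotate α T ≡ just T' → ∀ acc → rsAcc T' acc ≤* rsAcc T acc
rotate-rsAcc [] (t₀ ∧ (t₁ ∧ t₂)) refl acc =
  rsAcc-mono t₀ (m≤n⇒m≤1+n (m≤m+n (size t₁) (size t₂)) ∷ ≤*-refl)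
rotate-rsAcc (false ∷ α) (A ∧ B) h acc with map-just⁻ (rotate α A) h
... | A' , e , refl = rotate-rsAcc α A e _
rotate-rsAcc (true ∷ α) (A ∧ B) h acc with map-just⁻ (rotate α B) h
... | B' , e , refl = rsAcc-mono A (≤-reflexive (rotate-size α B e) ∷ rotate-rsAcc α B e acc)

rotate-⊑ : ∀ α T {T'} → rotate α T ≡ just T' → T ⊑ T'
rotate-⊑ α T e = below (rotate-rsAcc α T e [])

*-size : ∀ T u {T'} → T * u ≡ just T' → size T' ≡ size T
*-size T [] refl = refl
*-size T (α ∷ u) h with bind-just⁻ (rotate α T) h
... | T₁ , e , h' = trans (*-size T₁ u h') (rotate-size α T e)

*-⊑ : ∀ T u {T'} → T * u ≡ just T' → T ⊑ T'
*-⊑ T [] refl = ⊑-refl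
*-⊑ T (α ∷ u) h with bind-just⁻ (rotate α T) h
... | T₁ , e , h' = ⊑-trans (rotate-⊑ α T e) (*-⊑ T₁ u h')

rotate⇒* : ∀ α T {T'} → rotate α T ≡ just T' → T * (α ∷ []) ≡ just T'
rotate⇒* α T e rewrite e = refl

*-left : ∀ T u B {T'} → T * u ≡ just T' → (T ∧ B) * map (false ∷_) u ≡ just (T' ∧ B)
*-left T [] B refl = refl
*-left T (α ∷ u) B h with bind-just⁻ (rotate α T) h
... | T₁ , e , h' rewrite e = *-left T₁ u B h'

*-right : ∀ A u T {T'} → T * u ≡ just T' → (A ∧ T) * map (true ∷_) u ≡ just (A ∧ T')
*-right A [] T refl = refl
*-right A (α ∷ u) T h with bind-just⁻ (rotate α T) h
... | T₁ , e , h' rewrite e = *-right A u T₁ h'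

data Choice {A : Set} : List A → List A → List A → Set where
  [] : Choice [] [] []
  _∷_ : ∀ {x y z xs ys zs} → (z ≡ x ⊎ z ≡ y) → Choice xs ys zs →
        Choice (x ∷ xs) (y ∷ ys) (z ∷ zs)

Choice-sym : ∀ {A : Set} {xs ys zs : List A} → Choice xs ys zs → Choice ys xs zs
Choice-sym [] = []
Choice-sym (inj₁ e ∷ c) = inj₂ e ∷ Choice-sym c
Choice-sym (inj₂ e ∷ c) = inj₁ e ∷ Choice-sym c

Choice-keepˡ : ∀ {A : Set} (xs ys : List A) → length xs ≡ length ys → Choice xs ys xs
Choice-keepˡ [] [] _ = []
Choice-keepˡ (x ∷ xs) (y ∷ ys) e = inj₁ refl ∷ Choice-keepˡ xs ys (suc-injective e)

Choice-keepʳ : ∀ {A : Set} (xs ys : List A) → length xs ≡ length ys → Choice xs ys ys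
Choice-keepʳ xs ys e = Choice-sym (Choice-keepˡ ys xs (sym e))

Choice-++ : ∀ {A : Set} {a b c a' b' c' : List A} →
  Choice a b c → Choice a' b' c' → Choice (a ++ a') (b ++ b') (c ++ c')
Choice-++ [] c' = c'
Choice-++ (e ∷ c) c' = e ∷ Choice-++ c c'

≤*-Choice : ∀ {s xs ys zs} → s ≤* xs → s ≤* ys → Choice xs ys zs → s ≤* zs
≤*-Choice [] [] [] = []
≤*-Choice (p ∷ ps) (_ ∷ qs) (inj₁ refl ∷ c) = p ∷ ≤*-Choice ps qs c
≤*-Choice (_ ∷ ps) (q ∷ qs) (inj₂ refl ∷ c) = q ∷ ≤*-Choice ps qs c

⊑-Choice : ∀ {X Y W S} → X ⊑ S → Y ⊑ S → Choice (rs X) (rs Y) (rs W) → W ⊑ S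
⊑-Choice (below X⊑S) (below Y⊑S) c = below (≤*-Choice X⊑S Y⊑S c)

Choice-suffix : ∀ X Y W acc → Choice (rs X) (rs Y) (rs W) →
  Choice (rsAcc X acc) (rsAcc Y acc) (rsAcc W acc)
Choice-suffix X Y W acc c rewrite rsAcc-++ X acc | rsAcc-++ Y acc | rsAcc-++ W acc =
  Choice-++ c (Choice-keepˡ acc acc refl)

Choice-prefix : ∀ X Y {a b c} → size X ≡ size Y → Choice a b c →
  Choice (rsAcc X a) (rsAcc Y b) (rsAcc X c)
Choice-prefix X Y {a} {b} {c} e ch rewrite rsAcc-++ X a | rsAcc-++ Y b | rsAcc-++ X c =
  Choice-++ (Choice-keepˡ (rs X) (rs Y) (length-rs-cong e)) ch

record Square (a b : Address) (v u : PosWord) : Set where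
  field
    fill : ∀ S₀ {X Y} → rotate a S₀ ≡ just X → rotate b S₀ ≡ just Y →
      ∃[ W ] X * v ≡ just W × Y * u ≡ just W × Choice (rs X) (rs Y) (rs W)
open Square

square-sym : ∀ {a b v u} → Square a b v u → Square b a u v
fill (square-sym sq) S₀ hX hY = let (W , p , q , c) = fill sq S₀ hY hX in W , q , p , Choice-sym c

square-step : ∀ d {a b v u} → Square a b v u →
  Square (d ∷ a) (d ∷ b) (map (d ∷_) v) (map (d ∷_) u)
fill (square-step _ sq) ● () _
fill (square-step false {a} {b} {v} {u} sq) (A ∧ B) hX hY
  with map-just⁻ (rotate a A) hX | map-just⁻ (rotate b A) hY
... | XA , ea , refl | YA , eb , refl =
  let (W , p , q , c) = fill sq A ea eb in
  W ∧ B , *-left XA v B p , *-left YA u B q , Choice-suffix XA YA W _ c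
fill (square-step true {a} {b} {v} {u} sq) (A ∧ B) hX hY
  with map-just⁻ (rotate a B) hX | map-just⁻ (rotate b B) hY
... | XB , ea , refl | YB , eb , refl =
  let (W , p , q , c) = fill sq B ea eb in
  A ∧ W , *-right A v XB p , *-right A u YB q ,
  Choice-prefix A A refl (inj₁ (*-size XB v p) ∷ c)

square-lift : ∀ γ {a b} v u → Square a b v u →
  Square (γ ++ a) (γ ++ b) (map (γ ++_) v) (map (γ ++_) u)
square-lift [] {a} {b} v u sq =
  subst₂ (Square a b) (sym (map-id v)) (sym (map-id u)) sq
square-lift (d ∷ γ) {a} {b} v u sq =
  subst₂ (Square (d ∷ γ ++ a) (d ∷ γ ++ b)) (sym (map-∘ v)) (sym (map-∘ u))
    (square-step d (square-lift γ v u sq))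

square-comm : ∀ δ ζ → Square (false ∷ δ) (true ∷ ζ) ((true ∷ ζ) ∷ []) ((false ∷ δ) ∷ [])
fill (square-comm δ ζ) ● () _
fill (square-comm δ ζ) (A ∧ B) hX hY with map-just⁻ (rotate δ A) hX | map-just⁻ (rotate ζ B) hY
... | A' , ea , refl | B' , eb , refl =
  A' ∧ B' , *-right A' (ζ ∷ []) B (rotate⇒* ζ B eb) , *-left A (δ ∷ []) B' (rotate⇒* δ A ea) ,
  Choice-prefix A' A (rotate-size δ A ea)
    (inj₂ refl ∷ Choice-keepʳ (rs B) (rs B') (length-rs-cong (sym (rotate-size ζ B eb))))

square-11 : ∀ β → Square (true ∷ true ∷ β) [] ([] ∷ []) ((true ∷ β) ∷ [])
fill (square-11 β) (s₀ ∧ (s₁ ∧ s₂)) hX refl with map-just⁻ (Maybe.map (s₁ ∧_) (rotate β s₂)) hX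
... | _ , h , refl with map-just⁻ (rotate β s₂) h
... | s₂' , e , refl =
  (s₀ ∧ s₁) ∧ s₂' , refl , *-right (s₀ ∧ s₁) (β ∷ []) s₂ (rotate⇒* β s₂ e) ,
  Choice-prefix s₀ s₀ refl (inj₂ refl ∷ Choice-prefix s₁ s₁ refl (inj₁ refl ∷
    Choice-keepˡ (rs s₂') (rs s₂) (length-rs-cong (rotate-size β s₂ e))))

square-10 : ∀ β → Square (true ∷ false ∷ β) [] ([] ∷ []) ((false ∷ true ∷ β) ∷ [])
fill (square-10 β) (s₀ ∧ (s₁ ∧ s₂)) hX refl with map-just⁻ (Maybe.map (_∧ s₂) (rotate β s₁)) hX
... | _ , h , refl with map-just⁻ (rotate β s₁) h
... | s₁' , e , refl =
  (s₀ ∧ s₁') ∧ s₂ , refl ,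
  *-left (s₀ ∧ s₁) ((true ∷ β) ∷ []) s₂ (*-right s₀ (β ∷ []) s₁ (rotate⇒* β s₁ e)) ,
  Choice-prefix s₀ s₀ refl (inj₂ s≡ ∷ Choice-prefix s₁' s₁ s≡ (Choice-keepˡ _ _ refl))
  where
  s≡ : size s₁' ≡ size s₁
  s≡ = rotate-size β s₁ e

square-0 : ∀ β → Square (false ∷ β) [] ([] ∷ []) ((false ∷ false ∷ β) ∷ [])
fill (square-0 β) (s₀ ∧ (s₁ ∧ s₂)) hX refl with map-just⁻ (rotate β s₀) hX
... | s₀' , e , refl =
  (s₀' ∧ s₁) ∧ s₂ , refl ,
  *-left (s₀ ∧ s₁) ((false ∷ β) ∷ []) s₂ (*-left s₀ (β ∷ []) s₁ (rotate⇒* β s₀ e)) ,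
  Choice-prefix s₀' s₀ (rotate-size β s₀ e) (inj₂ refl ∷ Choice-keepˡ _ _ refl)

square-pentagon : Square [] (true ∷ []) ([] ∷ []) ([] ∷ (false ∷ []) ∷ [])
fill square-pentagon (s₀ ∧ (x ∧ (y ∧ z))) refl refl =
  ((s₀ ∧ x) ∧ y) ∧ z , refl , refl ,
  Choice-prefix s₀ s₀ refl (inj₁ refl ∷ Choice-prefix x x refl (inj₂ refl ∷ Choice-keepˡ _ _ refl))

square-R : ∀ {a b v u} → RelR (a ∷ v) (b ∷ u) → Square a b v u
square-R (comm _ _ (γ , δ , ζ , inj₁ (refl , refl))) =
  square-lift γ _ _ (square-comm δ ζ)
square-R (comm _ _ (γ , δ , ζ , inj₂ (refl , refl))) =
  square-lift γ _ _ (square-sym (square-comm ζ δ))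
square-R (r11 α β) =
  subst (λ z → Square (α ++ true ∷ true ∷ β) z (z ∷ []) ((α ++ true ∷ β) ∷ []))
    (++-identityʳ α) (square-lift α _ _ (square-11 β))
square-R (r10 α β) =
  subst (λ z → Square (α ++ true ∷ false ∷ β) z (z ∷ []) ((α ++ false ∷ true ∷ β) ∷ []))
    (++-identityʳ α) (square-lift α _ _ (square-10 β))
square-R (r0 α β) =
  subst (λ z → Square (α ++ false ∷ β) z (z ∷ []) ((α ++ false ∷ false ∷ β) ∷ []))
    (++-identityʳ α) (square-lift α _ _ (square-0 β))
square-R (pent α) =
  subst (λ z → Square z (α ++ true ∷ []) (z ∷ []) (z ∷ (α ++ false ∷ []) ∷ []))
    (++-identityʳ α) (square-lift α _ _ square-pentagon)

square-R± : ∀ {a b v u} → RelR (a ∷ v) (b ∷ u) ⊎ RelR (b ∷ u) (a ∷ v) → Square a b v u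
square-R± (inj₁ r) = square-R r
square-R± (inj₂ r) = square-sym (square-R r)

data Zigzag (S : Tree) : Tree → Word → Tree → Set where
  stop : ∀ {X} → X ⊑ S → Zigzag S X [] X
  fwd : ∀ {X X₁ Y α w} → X ⊑ S → rotate α X ≡ just X₁ → Zigzag S X₁ w Y →
        Zigzag S X (pos α ∷ w) Y
  bwd : ∀ {X X₁ Y α w} → X ⊑ S → rotate α X₁ ≡ just X → Zigzag S X₁ w Y →
        Zigzag S X (neg α ∷ w) Y

zigzag-start : ∀ {S X w Y} → Zigzag S X w Y → X ⊑ S
zigzag-start (stop b) = b
zigzag-start (fwd b _ _) = b
zigzag-start (bwd b _ _) = b

zigzag-++ : ∀ {S X M Y w₁ w₂} → Zigzag S X w₁ M → Zigzag S M w₂ Y → Zigzag S X (w₁ ++ w₂) Y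
zigzag-++ (stop _) q = q
zigzag-++ (fwd b r p) q = fwd b r (zigzag-++ p q)
zigzag-++ (bwd b r p) q = bwd b r (zigzag-++ p q)

zigzag-split : ∀ {S X Y} w₁ {w₂} → Zigzag S X (w₁ ++ w₂) Y →
  ∃[ M ] Zigzag S X w₁ M × Zigzag S M w₂ Y
zigzag-split [] p = _ , stop (zigzag-start p) , p
zigzag-split (pos _ ∷ w₁) (fwd b r p) = let (M , p₁ , p₂) = zigzag-split w₁ p in M , fwd b r p₁ , p₂
zigzag-split (neg _ ∷ w₁) (bwd b r p) = let (M , p₁ , p₂) = zigzag-split w₁ p in M , bwd b r p₁ , p₂

invW-∷ : ∀ α u → invW (α ∷ u) ≡ invW u ++ neg α ∷ []
invW-∷ α u = trans (cong (map neg) (unfold-reverse α u)) (map-++ neg (reverse u) (α ∷ []))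

forward-zigzag : ∀ {S} X u {Y} → X * u ≡ just Y → Y ⊑ S → Zigzag S X (posW u) Y
forward-zigzag X [] refl b = stop b
forward-zigzag X (α ∷ u) h b with bind-just⁻ (rotate α X) h
... | X₁ , e , h' = fwd (⊑-trans (*-⊑ X (α ∷ u) h) b) e (forward-zigzag X₁ u h' b)

backward-zigzag : ∀ {S} X u {Y} → X * u ≡ just Y → Y ⊑ S → Zigzag S Y (invW u) X
backward-zigzag X [] refl b = stop b
backward-zigzag {S} X (α ∷ u) {Y} h b with bind-just⁻ (rotate α X) h
... | X₁ , e , h' =
  subst (λ w → Zigzag S Y w X) (sym (invW-∷ α u))
    (zigzag-++ (backward-zigzag X₁ u h' b) (bwd X₁⊑S e (stop (⊑-trans (rotate-⊑ α X e) X₁⊑S))))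
  where
  X₁⊑S : X₁ ⊑ S
  X₁⊑S = ⊑-trans (*-⊑ X₁ u h') b

forward-word : ∀ {S} X u {Y} → Zigzag S X (posW u) Y → X * u ≡ just Y
forward-word X [] (stop _) = refl
forward-word X (α ∷ u) (fwd {X₁ = X₁} _ e p) rewrite e = forward-word X₁ u p

backward-word : ∀ {S} X u {Y} → Zigzag S Y (invW u) X → X * u ≡ just Y
backward-word X [] (stop _) = refl
backward-word {S} X (α ∷ u) {Y} p
  with zigzag-split (invW u) (subst (λ w → Zigzag S Y w X) (invW-∷ α u) p)
... | M , p₁ , bwd _ e (stop _) rewrite e = backward-word M u p₁

-- A right-reversing step preserves zigzags below S: a cancellation removes
-- a backtrack, and a reversing square replaces the peak by its completion,
-- which stays below S.
reversal-step-zigzag : ∀ {S X Y w w'} → RevStep w w' → Zigzag S X w Y → Zigzag S X w' Y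
reversal-step-zigzag {S} {Y = Y} (cancel x y a) p with zigzag-split x p
... | M , p₁ , bwd _ e₁ (fwd _ e₂ p₂) =
  zigzag-++ p₁ (subst (λ T → Zigzag S T y Y) (just-injective (trans (sym e₂) e₁)) p₂)
reversal-step-zigzag (rev x y a b u v rel) p with zigzag-split x p
... | M , p₁ , bwd M⊑S e₁ (fwd _ e₂ p₂) =
  let (W , hv , hu , c) = fill (square-R± rel) _ e₁ e₂
      W⊑S = ⊑-Choice M⊑S (zigzag-start p₂) c
  in zigzag-++ p₁ (zigzag-++ (forward-zigzag _ v hv W⊑S)
                             (zigzag-++ (backward-zigzag _ u hu W⊑S) p₂))

reversal-zigzag : ∀ {S X Y w w'} → w ↝* w' → Zigzag S X w Y → Zigzag S X w' Y
reversal-zigzag ε p = p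
reversal-zigzag (s ◅ ss) p = reversal-zigzag ss (reversal-step-zigzag s p)

c-word-zigzag : ∀ {S T T'} cT cT' → size T ≡ size T' → IsCWord T cT → IsCWord T' cT' →
  T ⊑ S → T' ⊑ S → Zigzag S T (invW cT ++ posW cT') T'
c-word-zigzag {T = T} {T'} cT cT' sT≡sT' hc hc' T⊑S T'⊑S =
  zigzag-++ (backward-zigzag (comb (size T)) cT hc T⊑S) (forward-zigzag (comb (size T)) cT' hc'' T'⊑S)
  where
  hc'' : comb (size T) * cT' ≡ just T'
  hc'' = subst (λ k → comb k * cT' ≡ just T') (sym sT≡sT') hc'

reversal-upper-bound : ∀ {S T T' w} N D → w ↝* (posW N ++ invW D) → Zigzag S T w T' →
  ∃[ Z ] T * N ≡ just Z × T' * D ≡ just Z × Z ⊑ S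
reversal-upper-bound {T = T} {T'} N D red p
  with zigzag-split (posW N) (reversal-zigzag red p)
... | Z , toZ , fromZ = Z , forward-word T N toZ , backward-word T' D fromZ , zigzag-start fromZ

proposition3p19 : (n : ℕ) (T T' T'' : Tree) → size T ≡ n → size T' ≡ n →
    IsLub n T T' T'' →
    (cT cT' : PosWord) → IsCWord T cT → IsCWord T' cT' →
    (N D : PosWord) → (invW cT ++ posW cT') ↝* (posW N ++ invW D) →
    (T * N ≡ just T'') × (T' * D ≡ just T'')
proposition3p19 n T T' T'' sT sT' (_ , (u , T≤T'') , (u' , T'≤T'') , least) cT cT' hc hc' N D red
  with reversal-upper-bound N D red
         (c-word-zigzag cT cT' (trans sT (sym sT')) hc hc' (*-⊑ T u T≤T'') (*-⊑ T' u' T'≤T''))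
... | Z , hN , hD , Z⊑T'' with least Z (trans (*-size T N hN) sT) (N , hN) (D , hD)
... | w , T''≤Z with ⊑-antisym Z⊑T'' (*-⊑ T'' w T''≤Z)
... | refl = hN , hD
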